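{- Let $A$ be a string of length $m$, $B=B_1\cdots B_n$ a string of length $n$, $X=X_1\cdots X_{2m}=AA$, and let $len$ and $parent$ be the LCS dynamic programming tables for $X$ and $B$ computed with the tie-breaking rule described in the context, whose parent pointers form a lowest shortest path tree $T$ of $G_{X,B}$ rooted at $(0,0)$. Remove the top-row nodes $(0,j)$, $0\le j\le n$, from $T$; let $L$ be the resulting tree containing $(1,0)$ and $R$ the other resulting tree (if any). If $(i,j)\in R$ and $(i,j-1)\in L$, then $len(i,j)=len(i,j-1)+1$.
   Context: $AA$ is the concatenation of $A$ with itself. $G_{X,B}$ is the directed graph with nodes $(i,j)$, $0\le i\le 2m$, $0\le j\le n$, and unit-length edges $(i,j-1)\to(i,j)$, $(i-1,j)\to(i,j)$, and $(i-1,j-1)\to(i,j)$ whenever $X_i=B_j$. The tables: $len(i,0)=len(0,j)=0$; for $i,j\ge1$, $len(i,j)$ is the maximum of $len(i,j-1)$ (option $\leftarrow$, parent $(i,j-1)$), $len(i-1,j)$ (option $\uparrow$, parent $(i-1,j)$), and, only if $X_i=B_j$, $len(i-1,j-1)+1$ (option $\nwarrow$, parent $(i-1,j-1)$); $parent(i,j)$ is an option attaining the maximum, ties broken by preferring $\leftarrow$, then $\nwarrow$, then $\uparrow$; $parent(0,j)=\leftarrow$ for $j\ge1$ and $parent(i,0)=\uparrow$ for $i\ge1$. The tree $T$ consists of the edges from each node's parent to the node. Removing the top row from $T$ leaves at most two trees. -}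

module Defs where

open import Data.Nat using (ℕ; zero; suc; _+_; _≤_; _⊔_)
open import Data.Nat.Properties using (_≟_)
open import Data.Bool using (Bool; true; false; if_then_else_)
open import Data.Maybe using (Maybe; just; nothing)
open import Data.List using (List; []; _∷_; _++_; length)
open import Data.Product using (_×_; _,_)
open import Relation.Binary.Definitions using (DecidableEquality)
open import Relation.Nullary using (does; ¬_)
open import Relation.Binary.PropositionalEquality using (_≡_)

-- 1-based character access: at s i = just s_i for 1 ≤ i ≤ |s|, nothing otherwise.
at : {Σ : Set} → List Σ → ℕ → Maybe Σ
at []       _             = nothing
at (c ∷ s)  zero          = nothing
at (c ∷ s)  (suc zero)    = just c
at (c ∷ s)  (suc (suc i)) = at s (suc i)

module LCS {Σ : Set} (_≟c_ : DecidableEquality Σ) (A B : List Σ) where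

  m : ℕ
  m = length A

  n : ℕ
  n = length B

  X : List Σ
  X = A ++ A

  match : ℕ → ℕ → Bool
  match i j with at X i | at B j
  ... | just x | just b = does (x ≟c b)
  ... | _      | _      = false

  len : ℕ → ℕ → ℕ
  len zero    j       = 0
  len (suc i) zero    = 0
  len (suc i) (suc j) =
    (len (suc i) j ⊔ len i (suc j)) ⊔
    (if match (suc i) (suc j) then suc (len i j) else 0)

  data Dir : Set where
    ←' ↖' ↑' : Dir

  -- the parent table, ties broken preferring ←, then ↖, then ↑.
  -- parent 0 0 (the root) is given the dummy value ← ; it is never used.
  parent : ℕ → ℕ → Dir
  parent zero    j       = ←'
  parent (suc i) zero    = ↑'
  parent (suc i) (suc j) =
    if does (len (suc i) j ≟ len (suc i) (suc j)) then ←'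
    else if (match (suc i) (suc j) Data.Bool.∧ does (suc (len i j) ≟ len (suc i) (suc j))) then ↖'
    else ↑'

  parentNode : ℕ → ℕ → ℕ × ℕ
  parentNode i j with parent i j
  ... | ←' = (i , j Data.Nat.∸ 1)
  ... | ↖' = (i Data.Nat.∸ 1 , j Data.Nat.∸ 1)
  ... | ↑' = (i Data.Nat.∸ 1 , j)

  Node : ℕ → ℕ → Set
  Node i j = (i ≤ m + m) × (j ≤ n)

  -- L : the tree containing (1,0) after removing the top row from T,
  -- i.e. the nodes reachable from (1,0) by T-edges (parent → child)
  -- without passing through row 0.
  data InL : ℕ → ℕ → Set where
    root : 1 ≤ m + m → InL 1 0
    step : ∀ {i j i' j'} → Node i j → parentNode i j ≡ (i' , j') →
           1 ≤ i' → InL i' j' → InL i j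

  -- R : the other tree, i.e. the non-top-row nodes not in L
  -- (removing the top row leaves at most two trees).
  InR : ℕ → ℕ → Set
  InR i j = Node i j × (1 ≤ i) × ¬ InL i j

-- Along a row the len table is non-decreasing and grows by at most one per step.
-- If len(i,j+1) = len(i,j), the tie-breaking rule makes (i,j) the parent of
-- (i,j+1), so (i,j+1) would lie in L together with (i,j); hence for (i,j+1) ∈ R
-- the step is strict, and therefore exactly one.
module Submission where

open import Defs
open import Data.Nat using (ℕ; zero; suc; _+_; _≤_; _<_; z≤n; s≤s; _∸_)
open import Data.Nat.Properties
open import Data.List using (List)
open import Data.Bool using (Bool; true; false; if_then_else_)
open import Data.Product using (_,_)
open import Relation.Nullary using (contradiction)
open import Relation.Nullary.Decidable using (dec-true)
open import Relation.Binary.Definitions using (DecidableEquality)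
open import Relation.Binary.PropositionalEquality using (_≡_; refl; trans)

module LCSProperties {Σ : Set} (_≟c_ : DecidableEquality Σ) (A B : List Σ) where
  open LCS _≟c_ A B

  matchTerm : Bool → ℕ → ℕ → ℕ
  matchTerm b i j = if b then suc (len i j) else 0

  len-monoʳ : ∀ i j → len i j ≤ len i (suc j)
  len-monoʳ zero    j = z≤n
  len-monoʳ (suc i) j = ≤-trans (m≤m⊔n (len (suc i) j) (len i (suc j)))
                                (m≤m⊔n _ (matchTerm (match (suc i) (suc j)) i j))

  len-monoˡ : ∀ i j → len i j ≤ len (suc i) j
  len-monoˡ zero    zero    = z≤n
  len-monoˡ (suc i) zero    = z≤n
  len-monoˡ i       (suc j) = ≤-trans (m≤n⊔m (len (suc i) j) (len i (suc j)))
                                      (m≤m⊔n _ (matchTerm (match (suc i) (suc j)) i j))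

  matchTerm≤ : ∀ b i j → matchTerm b i j ≤ suc (len (suc i) j)
  matchTerm≤ true  i j = s≤s (len-monoˡ i j)
  matchTerm≤ false i j = z≤n

  len-stepʳ : ∀ i j → len i (suc j) ≤ suc (len i j)
  len-stepʳ zero    j = z≤n
  len-stepʳ (suc i) j =
    ⊔-lub (⊔-lub (n≤1+n _) (≤-trans (len-stepʳ i j) (s≤s (len-monoˡ i j))))
          (matchTerm≤ (match (suc i) (suc j)) i j)

  parent-← : ∀ i j → len (suc i) j ≡ len (suc i) (suc j) → parent (suc i) (suc j) ≡ ←'
  parent-← i j eq rewrite dec-true (len (suc i) j ≟ len (suc i) (suc j)) eq = refl

  parentNode-← : ∀ i j → parent i j ≡ ←' → parentNode i j ≡ (i , j ∸ 1)
  parentNode-← i j p with parent i j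
  parentNode-← i j refl | ←' = refl

  InL-stepʳ : ∀ i j → Node (suc i) (suc j) → InL (suc i) j →
              len (suc i) j ≡ len (suc i) (suc j) → InL (suc i) (suc j)
  InL-stepʳ i j node inL eq =
    step node (parentNode-← (suc i) (suc j) (parent-← i j eq)) (s≤s z≤n) inL

  len-stepʳ-InR : ∀ i j → InR i (suc j) → InL i j → len i (suc j) ≡ len i j + 1
  len-stepʳ-InR zero    j (_ , () , _) _
  len-stepʳ-InR (suc i) j (node , _ , ∉L) inL =
    trans (≤-antisym (len-stepʳ (suc i) j) strict) (+-comm 1 _)
    where
    strict : len (suc i) j < len (suc i) (suc j)
    strict = ≤∧≢⇒< (len-monoʳ (suc i) j) (λ eq → contradiction (InL-stepʳ i j node inL eq) ∉L)

corollary2 : {Σ : Set} (_≟c_ : DecidableEquality Σ) (A B : List Σ) (i j : ℕ) →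
    LCS.InR _≟c_ A B i (suc j) → LCS.InL _≟c_ A B i j →
    LCS.len _≟c_ A B i (suc j) ≡ LCS.len _≟c_ A B i j + 1
corollary2 _≟c_ A B = LCSProperties.len-stepʳ-InR _≟c_ A B
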